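{- For every integer $n\ge1$, $$\frac{1}{2^n}\sum_{b=0}^{2^n-1}\left(T^1_n(b)-\frac{3^{M_{n-1}(b)}}{2^n}\,b\right)=\frac{n}{4}.$$
   Context: Let $T^1:\mathbb{N}\to\mathbb{N}$ be the Collatz function, $T^1(N)=N/2$ if $N$ is even and $T^1(N)=\frac{3N+1}{2}$ if $N$ is odd; in particular $T^1(0)=0$. Write $T^1_k$ for the $k$-th iterate of $T^1$, with $T^1_0$ the identity. For an integer $n\ge1$ and $b\in\{0,\dots,2^n-1\}$, let $M_{n-1}(b)$ be the number of odd integers among $b, T^1_1(b),\dots,T^1_{n-1}(b)$. In particular $M_{n-1}(0)=0$ and $T^1_n(0)=0$. -}

module Defs where

open import Data.Nat using (ℕ; zero; suc; _+_; _*_; _^_)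
open import Data.Nat.Base using (_/_; _%_)
open import Data.List using (List; map; upTo; foldr)
open import Data.Nat.ListAction using (sum)
import Data.Rational as Q

T1 : ℕ → ℕ
T1 N with N % 2
... | zero = N / 2
... | suc _ = (3 * N + 1) / 2

T1-iter : ℕ → ℕ → ℕ
T1-iter zero    N = N
T1-iter (suc k) N = T1-iter k (T1 N)

oddInd : ℕ → ℕ
oddInd N = N % 2

-- M_{k}(b) = number of odd integers among b, T¹_1(b), …, T¹_k(b)
-- (i.e. among T¹_i(b) for i = 0, …, k)
M : ℕ → ℕ → ℕ
M k b = sum (map (λ i → oddInd (T1-iter i b)) (upTo (suc k)))

sumℚ : List Q.ℚ → Q.ℚ
sumℚ = foldr Q._+_ Q.0ℚ

module Submission where

-- Writing T_k for the k-th iterate, induction on k gives 2^k T_k(b) = 3^(M_{k-1}(b)) b + c_k(b)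
-- for an "offset" c_k(b) with c_{k+1}(b) = 3^o c_k(b) + o 2^k, where o is the parity of T_k(b).
-- Since T_k(b + 2^k t) = T_k(b) + 3^(M_{k-1}(b)) t, the parity sequence and the offset c_k
-- depend only on b mod 2^k, while T_k(b) and T_k(b + 2^k) have opposite parities.  Hence
-- c_{k+1}(b) + c_{k+1}(b + 2^k) = 4 c_k(b) + 2^k, so S_k := Σ_{b < 2^k} c_k(b) satisfies
-- S_{k+1} = 4 S_k + 4^k, i.e. 4 S_n = n 4^n.  The sum in the theorem is S_n / 4^n.

open import Defs
open import Data.List using (List; []; _∷_; map; upTo)
open import Data.List.Properties using (map-cong)
open import Data.Nat as ℕ using (ℕ; suc; _^_; NonZero)
open import Data.Nat.ListAction using (sum)
open import Data.Nat.Properties using (*-comm; *-identityʳ; m*n≢0; m^n≢0)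
open import Relation.Binary.PropositionalEquality

module Iterates where
  open import Data.List using (_++_; applyUpTo; _∷ʳ_; length)
  open import Data.List.Properties using (map-upTo; map-++; map-∘; applyUpTo-∷ʳ; length-upTo)
  open import Data.Nat using (zero; _+_; _*_; _/_)
  open import Data.Nat.DivMod using (m*n%n≡0; m*n/n≡m; [m+kn]%n≡m%n)
  open import Data.Nat.ListAction.Properties using (sum-++)
  open import Data.Nat.Properties
    using (+-comm; +-identityʳ; *-zeroʳ; *-distribˡ-+; *-cancelˡ-≡; ^-distribˡ-+-*)
  open import Data.Nat.Tactic.RingSolver using (solve-∀)
  open import Function using (_∘_; const; id)
  open ≡-Reasoning

  data Parity : ℕ → Set where
    even : ∀ q → Parity (q * 2)
    odd  : ∀ q → Parity (1 + q * 2)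

  parity : ∀ n → Parity n
  parity zero = even 0
  parity (suc n) with parity n
  ... | even q = odd q
  ... | odd q  = even (suc q)

  oddInd-even : ∀ q → oddInd (q * 2) ≡ 0
  oddInd-even q = m*n%n≡0 q 2

  oddInd-odd : ∀ q → oddInd (1 + q * 2) ≡ 1
  oddInd-odd q = [m+kn]%n≡m%n 1 q 2

  oddInd-+2* : ∀ n u → oddInd (n + 2 * u) ≡ oddInd n
  oddInd-+2* n u = trans (cong (λ v → oddInd (n + v)) (*-comm 2 u)) ([m+kn]%n≡m%n n u 2)

  oddInd+oddInd[1+n]≡1 : ∀ n → oddInd n + oddInd (suc n) ≡ 1
  oddInd+oddInd[1+n]≡1 n with parity n
  ... | even q rewrite oddInd-even q = oddInd-odd q
  ... | odd q  rewrite oddInd-odd q | oddInd-even (suc q) = refl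

  oddInd-+3^ : ∀ n j → oddInd (n + 3 ^ j) ≡ oddInd (suc n)
  oddInd-+3^ n zero    = cong oddInd (+-comm n 1)
  oddInd-+3^ n (suc j) = begin
    oddInd (n + 3 * 3 ^ j)         ≡⟨ cong oddInd (split n (3 ^ j)) ⟩
    oddInd (n + 3 ^ j + 2 * 3 ^ j) ≡⟨ oddInd-+2* (n + 3 ^ j) (3 ^ j) ⟩
    oddInd (n + 3 ^ j)             ≡⟨ oddInd-+3^ n j ⟩
    oddInd (suc n)                 ∎
    where
    split : ∀ n p → n + 3 * p ≡ n + p + 2 * p
    split = solve-∀

  T1-even : ∀ q → T1 (q * 2) ≡ q
  T1-even q rewrite oddInd-even q = m*n/n≡m q 2

  T1-odd : ∀ q → T1 (1 + q * 2) ≡ 2 + q * 3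
  T1-odd q rewrite oddInd-odd q = trans (cong (_/ 2) (expand q)) (m*n/n≡m (2 + q * 3) 2)
    where
    expand : ∀ q → 3 * (1 + q * 2) + 1 ≡ (2 + q * 3) * 2
    expand = solve-∀

  2*T1 : ∀ n → 2 * T1 n ≡ 3 ^ oddInd n * n + oddInd n
  2*T1 n with parity n
  ... | even q rewrite T1-even q | oddInd-even q = even-case q
    where
    even-case : ∀ q → 2 * q ≡ 1 * (q * 2) + 0
    even-case = solve-∀
  ... | odd q rewrite T1-odd q | oddInd-odd q = odd-case q
    where
    odd-case : ∀ q → 2 * (2 + q * 3) ≡ 3 * (1 + q * 2) + 1
    odd-case = solve-∀

  T1-+2* : ∀ n u → T1 (n + 2 * u) ≡ T1 n + 3 ^ oddInd n * u
  T1-+2* n u = *-cancelˡ-≡ (T1 (n + 2 * u)) _ 2 (begin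
    2 * T1 (n + 2 * u)                         ≡⟨ 2*T1 (n + 2 * u) ⟩
    3 ^ o′ * (n + 2 * u) + o′                  ≡⟨ cong (λ o → 3 ^ o * (n + 2 * u) + o) (oddInd-+2* n u) ⟩
    3 ^ o * (n + 2 * u) + o                    ≡⟨ regroup (3 ^ o) n u o ⟩
    (3 ^ o * n + o) + 2 * (3 ^ o * u)          ≡⟨ cong (_+ 2 * (3 ^ o * u)) (2*T1 n) ⟨
    2 * T1 n + 2 * (3 ^ o * u)                 ≡⟨ *-distribˡ-+ 2 (T1 n) _ ⟨
    2 * (T1 n + 3 ^ o * u)                     ∎)
    where
    o = oddInd n
    o′ = oddInd (n + 2 * u)
    regroup : ∀ p n u o → p * (n + 2 * u) + o ≡ (p * n + o) + 2 * (p * u)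
    regroup = solve-∀

  T1-iter-suc : ∀ k b → T1-iter (suc k) b ≡ T1 (T1-iter k b)
  T1-iter-suc zero    b = refl
  T1-iter-suc (suc k) b = T1-iter-suc k (T1 b)

  oddCount : ℕ → ℕ → ℕ
  oddCount zero    b = 0
  oddCount (suc k) b = oddCount k b + oddInd (T1-iter k b)

  M≡oddCount : ∀ m b → M m b ≡ oddCount (suc m) b
  M≡oddCount m b = trans (cong sum (map-upTo _ (suc m))) (go (suc m))
    where
    go : ∀ k → sum (applyUpTo (λ i → oddInd (T1-iter i b)) k) ≡ oddCount k b
    go zero    = refl
    go (suc k) = begin
      sum (applyUpTo f (suc k))                  ≡⟨ cong sum (applyUpTo-∷ʳ f k) ⟨
      sum (applyUpTo f k ∷ʳ f k)                 ≡⟨ sum-++ (applyUpTo f k) (f k ∷ []) ⟩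
      sum (applyUpTo f k) + (f k + 0)            ≡⟨ cong₂ _+_ (go k) (+-identityʳ (f k)) ⟩
      oddCount k b + f k                         ∎
      where
      f = λ i → oddInd (T1-iter i b)

  offset : ℕ → ℕ → ℕ
  offset zero    b = 0
  offset (suc k) b = 3 ^ o * offset k b + o * 2 ^ k
    where o = oddInd (T1-iter k b)

  2^suc-* : ∀ k t → 2 ^ suc k * t ≡ 2 ^ k * (2 * t)
  2^suc-* k t = shuffle (2 ^ k) t
    where
    shuffle : ∀ a t → 2 * a * t ≡ a * (2 * t)
    shuffle = solve-∀

  2^k*T1-iter≡3^oddCount*b+offset : ∀ k b → 2 ^ k * T1-iter k b ≡ 3 ^ oddCount k b * b + offset k b
  2^k*T1-iter≡3^oddCount*b+offset zero    b = sym (+-identityʳ (1 * b))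
  2^k*T1-iter≡3^oddCount*b+offset (suc k) b = begin
    2 * 2 ^ k * T1-iter (suc k) b                   ≡⟨ cong (2 * 2 ^ k *_) (T1-iter-suc k b) ⟩
    2 ^ suc k * T1 y                                ≡⟨ 2^suc-* k (T1 y) ⟩
    2 ^ k * (2 * T1 y)                              ≡⟨ cong (2 ^ k *_) (2*T1 y) ⟩
    2 ^ k * (3 ^ o * y + o)                         ≡⟨ distrib (2 ^ k) (3 ^ o) y o ⟩
    3 ^ o * (2 ^ k * y) + o * 2 ^ k                 ≡⟨ cong (λ z → 3 ^ o * z + o * 2 ^ k) (2^k*T1-iter≡3^oddCount*b+offset k b) ⟩
    3 ^ o * (3 ^ m * b + offset k b) + o * 2 ^ k    ≡⟨ collect (3 ^ o) (3 ^ m) b (offset k b) (o * 2 ^ k) ⟩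
    3 ^ m * 3 ^ o * b + offset (suc k) b            ≡⟨ cong (λ z → z * b + offset (suc k) b) (^-distribˡ-+-* 3 m o) ⟨
    3 ^ (m + o) * b + offset (suc k) b              ∎
    where
    y = T1-iter k b
    o = oddInd y
    m = oddCount k b
    distrib : ∀ a p y o → a * (p * y + o) ≡ p * (a * y) + o * a
    distrib = solve-∀
    collect : ∀ p q b c e → p * (q * b + c) + e ≡ q * p * b + (p * c + e)
    collect = solve-∀

  2^[1+m]*T1-iter≡3^M*b+offset : ∀ m b → 2 ^ suc m * T1-iter (suc m) b ≡ 3 ^ M m b * b + offset (suc m) b
  2^[1+m]*T1-iter≡3^M*b+offset m b =
    trans (2^k*T1-iter≡3^oddCount*b+offset (suc m) b) (cong (λ e → 3 ^ e * b + offset (suc m) b) (sym (M≡oddCount m b)))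

  T1-iter-shift : ∀ k b t → T1-iter k (b + 2 ^ k * t) ≡ T1-iter k b + 3 ^ oddCount k b * t

  T1-iter-shift-even : ∀ k b t → T1-iter k (b + 2 ^ suc k * t) ≡ T1-iter k b + 2 * (3 ^ oddCount k b * t)
  T1-iter-shift-even k b t = begin
    T1-iter k (b + 2 ^ suc k * t)         ≡⟨ cong (λ z → T1-iter k (b + z)) (2^suc-* k t) ⟩
    T1-iter k (b + 2 ^ k * (2 * t))       ≡⟨ T1-iter-shift k b (2 * t) ⟩
    T1-iter k b + 3 ^ m * (2 * t)         ≡⟨ cong (T1-iter k b +_) (swap (3 ^ m) t) ⟩
    T1-iter k b + 2 * (3 ^ m * t)         ∎
    where
    m = oddCount k b
    swap : ∀ p t → p * (2 * t) ≡ 2 * (p * t)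
    swap = solve-∀

  T1-iter-shift zero    b t = refl
  T1-iter-shift (suc k) b t = begin
    T1-iter (suc k) (b + 2 ^ suc k * t)       ≡⟨ T1-iter-suc k _ ⟩
    T1 (T1-iter k (b + 2 ^ suc k * t))        ≡⟨ cong T1 (T1-iter-shift-even k b t) ⟩
    T1 (y + 2 * (3 ^ m * t))                  ≡⟨ T1-+2* y (3 ^ m * t) ⟩
    T1 y + 3 ^ o * (3 ^ m * t)                ≡⟨ cong₂ _+_ (T1-iter-suc k b) (assoc (3 ^ o) (3 ^ m) t) ⟨
    T1-iter (suc k) b + 3 ^ m * 3 ^ o * t     ≡⟨ cong (λ z → T1-iter (suc k) b + z * t) (^-distribˡ-+-* 3 m o) ⟨
    T1-iter (suc k) b + 3 ^ (m + o) * t       ∎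
    where
    y = T1-iter k b
    o = oddInd y
    m = oddCount k b
    assoc : ∀ p q t → q * p * t ≡ p * (q * t)
    assoc = solve-∀

  oddInd-T1-iter-shift : ∀ k b t → oddInd (T1-iter k (b + 2 ^ suc k * t)) ≡ oddInd (T1-iter k b)
  oddInd-T1-iter-shift k b t =
    trans (cong oddInd (T1-iter-shift-even k b t)) (oddInd-+2* (T1-iter k b) (3 ^ oddCount k b * t))

  offset-shift : ∀ k b t → offset k (b + 2 ^ k * t) ≡ offset k b
  offset-shift zero    b t = refl
  offset-shift (suc k) b t
    rewrite oddInd-T1-iter-shift k b t | 2^suc-* k t | offset-shift k b (2 * t) = refl

  complementary-steps : ∀ o o′ c a → o + o′ ≡ 1 → (3 ^ o * c + o * a) + (3 ^ o′ * c + o′ * a) ≡ 4 * c + a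
  complementary-steps 0 1 c a refl = even-odd c a
    where
    even-odd : ∀ c a → (1 * c + 0 * a) + (3 * c + 1 * a) ≡ 4 * c + a
    even-odd = solve-∀
  complementary-steps 1 0 c a refl = odd-even c a
    where
    odd-even : ∀ c a → (3 * c + 1 * a) + (1 * c + 0 * a) ≡ 4 * c + a
    odd-even = solve-∀

  T1-iter-+2^k-flips-parity : ∀ k b → oddInd (T1-iter k b) + oddInd (T1-iter k (b + 2 ^ k)) ≡ 1
  T1-iter-+2^k-flips-parity k b = begin
    oddInd y + oddInd (T1-iter k (b + 2 ^ k))         ≡⟨ cong (λ z → oddInd y + oddInd (T1-iter k (b + z))) (*-identityʳ (2 ^ k)) ⟨
    oddInd y + oddInd (T1-iter k (b + 2 ^ k * 1))     ≡⟨ cong (λ z → oddInd y + oddInd z) (T1-iter-shift k b 1) ⟩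
    oddInd y + oddInd (y + 3 ^ oddCount k b * 1)      ≡⟨ cong (λ z → oddInd y + oddInd (y + z)) (*-identityʳ _) ⟩
    oddInd y + oddInd (y + 3 ^ oddCount k b)          ≡⟨ cong (oddInd y +_) (oddInd-+3^ y (oddCount k b)) ⟩
    oddInd y + oddInd (suc y)                         ≡⟨ oddInd+oddInd[1+n]≡1 y ⟩
    1                                                 ∎
    where y = T1-iter k b

  offset-pair : ∀ k b → offset (suc k) b + offset (suc k) (2 ^ k + b) ≡ 4 * offset k b + 2 ^ k
  offset-pair k b = begin
    offset (suc k) b + offset (suc k) (2 ^ k + b)    ≡⟨ cong (λ z → offset (suc k) b + offset (suc k) z) (+-comm (2 ^ k) b) ⟩
    offset (suc k) b + offset (suc k) (b + 2 ^ k)    ≡⟨ cong (λ z → offset (suc k) b + (3 ^ o′ * z + o′ * 2 ^ k)) offset-b′ ⟩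
    (3 ^ o * c + o * 2 ^ k) + (3 ^ o′ * c + o′ * 2 ^ k) ≡⟨ complementary-steps o o′ c (2 ^ k) (T1-iter-+2^k-flips-parity k b) ⟩
    4 * c + 2 ^ k                                     ∎
    where
    c = offset k b
    o = oddInd (T1-iter k b)
    o′ = oddInd (T1-iter k (b + 2 ^ k))
    offset-b′ : offset k (b + 2 ^ k) ≡ c
    offset-b′ = trans (cong (λ z → offset k (b + z)) (sym (*-identityʳ (2 ^ k)))) (offset-shift k b 1)

  upTo-+ : ∀ m n → upTo (m + n) ≡ upTo m ++ map (m +_) (upTo n)
  upTo-+ m n = trans (applyUpTo-+ id m n) (cong (upTo m ++_) (sym (map-upTo (m +_) n)))
    where
    applyUpTo-+ : ∀ {a} {A : Set a} (f : ℕ → A) m n → applyUpTo f (m + n) ≡ applyUpTo f m ++ applyUpTo (f ∘ (m +_)) n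
    applyUpTo-+ f zero    n = refl
    applyUpTo-+ f (suc m) n = cong (f 0 ∷_) (applyUpTo-+ (f ∘ suc) m n)

  sum-map-+ : ∀ {a} {A : Set a} (f g : A → ℕ) xs → sum (map (λ x → f x + g x) xs) ≡ sum (map f xs) + sum (map g xs)
  sum-map-+ f g []       = refl
  sum-map-+ f g (x ∷ xs) rewrite sum-map-+ f g xs = interchange (f x) (g x) (sum (map f xs)) (sum (map g xs))
    where
    interchange : ∀ a b c d → a + b + (c + d) ≡ a + c + (b + d)
    interchange = solve-∀

  sum-map-*ˡ : ∀ {a} {A : Set a} c (f : A → ℕ) xs → sum (map (λ x → c * f x) xs) ≡ c * sum (map f xs)
  sum-map-*ˡ c f []       = sym (*-zeroʳ c)
  sum-map-*ˡ c f (x ∷ xs) = trans (cong (c * f x +_) (sum-map-*ˡ c f xs)) (sym (*-distribˡ-+ c (f x) _))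

  sum-map-const : ∀ {a} {A : Set a} c (xs : List A) → sum (map (const c) xs) ≡ length xs * c
  sum-map-const c []       = refl
  sum-map-const c (x ∷ xs) = cong (c +_) (sum-map-const c xs)

  sum-offset : ∀ k → sum (map (offset k) (upTo (2 ^ k))) * 4 ≡ k * (2 ^ k * 2 ^ k)
  sum-offset zero    = refl
  sum-offset (suc k) = begin
    sum (map f′ (upTo (2 * a))) * 4                                     ≡⟨ cong (λ n → sum (map f′ (upTo n)) * 4) (double a) ⟩
    sum (map f′ (upTo (a + a))) * 4                                     ≡⟨ cong (λ xs → sum (map f′ xs) * 4) (upTo-+ a a) ⟩
    sum (map f′ (upTo a ++ map (a +_) (upTo a))) * 4                    ≡⟨ cong (λ xs → sum xs * 4) (map-++ f′ (upTo a) _) ⟩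
    sum (map f′ (upTo a) ++ map f′ (map (a +_) (upTo a))) * 4           ≡⟨ cong (_* 4) (sum-++ (map f′ (upTo a)) _) ⟩
    (sum (map f′ (upTo a)) + sum (map f′ (map (a +_) (upTo a)))) * 4    ≡⟨ cong (λ xs → (sum (map f′ (upTo a)) + sum xs) * 4) (map-∘ (upTo a)) ⟨
    (sum (map f′ (upTo a)) + sum (map (f′ ∘ (a +_)) (upTo a))) * 4      ≡⟨ cong (_* 4) (sum-map-+ f′ (f′ ∘ (a +_)) (upTo a)) ⟨
    sum (map (λ b → f′ b + f′ (a + b)) (upTo a)) * 4                    ≡⟨ cong (λ xs → sum xs * 4) (map-cong (offset-pair k) (upTo a)) ⟩
    sum (map (λ b → 4 * f b + a) (upTo a)) * 4                          ≡⟨ cong (_* 4) (sum-map-+ (λ b → 4 * f b) (const a) (upTo a)) ⟩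
    (sum (map (λ b → 4 * f b) (upTo a)) + sum (map (const a) (upTo a))) * 4
        ≡⟨ cong₂ (λ x y → (x + y) * 4) (sum-map-*ˡ 4 f (upTo a)) (trans (sum-map-const a (upTo a)) (cong (_* a) (length-upTo a))) ⟩
    (4 * S + a * a) * 4                                                 ≡⟨ regroup S (a * a) ⟩
    4 * (S * 4) + 4 * (a * a)                                           ≡⟨ cong (λ z → 4 * z + 4 * (a * a)) (sum-offset k) ⟩
    4 * (k * (a * a)) + 4 * (a * a)                                     ≡⟨ finish k a ⟩
    suc k * (2 * a * (2 * a))                                           ∎
    where
    a = 2 ^ k
    f = offset k
    f′ = offset (suc k)
    S = sum (map f (upTo a))
    double : ∀ a → 2 * a ≡ a + a
    double = solve-∀
    regroup : ∀ s q → (4 * s + q) * 4 ≡ 4 * (s * 4) + 4 * q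
    regroup = solve-∀
    finish : ∀ k a → 4 * (k * (a * a)) + 4 * (a * a) ≡ suc k * (2 * a * (2 * a))
    finish = solve-∀

open Iterates

open import Data.Integer as ℤ using (+_)
open import Data.Integer.Properties as ℤ using (pos-*)
open import Data.Integer.Tactic.RingSolver using (solve-∀)
open import Data.Rational using (_+_; _-_; _*_; _/_; toℚᵘ)
open import Data.Rational.Properties
  using (toℚᵘ-fromℚᵘ; toℚᵘ-injective; toℚᵘ-homo-+; toℚᵘ-homo-*; 0/n≡0; +-0-abelianGroup)
import Data.Rational.Unnormalised as U
import Data.Rational.Unnormalised.Properties as UP
open import Algebra.Properties.AbelianGroup +-0-abelianGroup using (xyx⁻¹≈y)

toℚᵘ-/ : ∀ i d .{{_ : NonZero d}} → toℚᵘ (i / d) U.≃ i U./ d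
toℚᵘ-/ i (suc d) = toℚᵘ-fromℚᵘ (U.mkℚᵘ i d)

/-≡-/ : ∀ i j d e .{{_ : NonZero d}} .{{_ : NonZero e}} → i ℤ.* + e ≡ j ℤ.* + d → i / d ≡ j / e
/-≡-/ i j (suc d) (suc e) eq = toℚᵘ-injective (UP.≃-trans (toℚᵘ-/ i (suc d)) (UP.≃-trans (U.*≡* eq) (UP.≃-sym (toℚᵘ-/ j (suc e)))))

/-+-/ : ∀ i j d .{{_ : NonZero d}} → i / d + j / d ≡ (i ℤ.+ j) / d
/-+-/ i j d@(suc d-1) = toℚᵘ-injective (begin
  toℚᵘ (i / d + j / d)                 ≈⟨ toℚᵘ-homo-+ (i / d) (j / d) ⟩
  toℚᵘ (i / d) U.+ toℚᵘ (j / d)        ≈⟨ UP.+-cong (toℚᵘ-/ i d) (toℚᵘ-/ j d) ⟩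
  i U./ d U.+ j U./ d                  ≈⟨ U.*≡* (trans (factor i j (+ d)) (cong ((i ℤ.+ j) ℤ.*_) (sym (pos-* d d)))) ⟩
  (i ℤ.+ j) U./ d                      ≈⟨ toℚᵘ-/ (i ℤ.+ j) d ⟨
  toℚᵘ ((i ℤ.+ j) / d)                 ∎)
  where
  open UP.≃-Reasoning
  factor : ∀ i j s → (i ℤ.* s ℤ.+ j ℤ.* s) ℤ.* s ≡ (i ℤ.+ j) ℤ.* (s ℤ.* s)
  factor = solve-∀

/-*-/ : ∀ i j d e .{{_ : NonZero d}} .{{_ : NonZero e}} →
        (i / d) * (j / e) ≡ _/_ (i ℤ.* j) (d ℕ.* e) {{m*n≢0 d e}}
/-*-/ i j d@(suc _) e@(suc _) = toℚᵘ-injective (begin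
  toℚᵘ ((i / d) * (j / e))            ≈⟨ toℚᵘ-homo-* (i / d) (j / e) ⟩
  toℚᵘ (i / d) U.* toℚᵘ (j / e)       ≈⟨ UP.*-cong (toℚᵘ-/ i d) (toℚᵘ-/ j e) ⟩
  (i ℤ.* j) U./ (d ℕ.* e)             ≈⟨ toℚᵘ-/ (i ℤ.* j) (d ℕ.* e) ⟨
  toℚᵘ ((i ℤ.* j) / (d ℕ.* e))        ∎)
  where open UP.≃-Reasoning

sumℚ-map-/ : ∀ {a} {A : Set a} (f : A → ℕ) d .{{_ : NonZero d}} xs →
             sumℚ (map (λ x → + f x / d) xs) ≡ + sum (map f xs) / d
sumℚ-map-/ f d []       = sym (0/n≡0 d)
sumℚ-map-/ f d (x ∷ xs) = trans (cong (_+_ (+ f x / d)) (sumℚ-map-/ f d xs)) (/-+-/ (+ f x) (+ sum (map f xs)) d)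

+/-≡-+/ : ∀ a b d e .{{_ : NonZero d}} .{{_ : NonZero e}} → a ℕ.* e ≡ b ℕ.* d → + a / d ≡ + b / e
+/-≡-+/ a b d e eq = /-≡-/ (+ a) (+ b) d e (trans (sym (pos-* a e)) (trans (cong +_ eq) (pos-* b d)))

-/-≡-/ : ∀ t a c d .{{_ : NonZero d}} → d ℕ.* t ≡ a ℕ.+ c → + t / 1 - + a / d ≡ + c / d
-/-≡-/ t a c d eq = begin
  + t / 1 - + a / d              ≡⟨ cong (_- + a / d) (+/-≡-+/ t (a ℕ.+ c) 1 d t*d≡[a+c]*1) ⟩
  + (a ℕ.+ c) / d - + a / d      ≡⟨ cong (_- + a / d) (/-+-/ (+ a) (+ c) d) ⟨
  + a / d + + c / d - + a / d    ≡⟨ xyx⁻¹≈y (+ a / d) (+ c / d) ⟩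
  + c / d                        ∎
  where
  open ≡-Reasoning
  t*d≡[a+c]*1 : t ℕ.* d ≡ (a ℕ.+ c) ℕ.* 1
  t*d≡[a+c]*1 = trans (*-comm t d) (trans eq (sym (*-identityʳ (a ℕ.+ c))))

mainTheorem6 : (m : ℕ) →
    (_/_ (+ 1) (2 ^ suc m) ⦃ m^n≢0 2 (suc m) ⦄) * sumℚ (map (λ b → ((+ (T1-iter (suc m) b)) / 1) - (_/_ (+ (3 ^ M m b ℕ.* b)) (2 ^ suc m) ⦃ m^n≢0 2 (suc m) ⦄)) (upTo (2 ^ suc m))) ≡ (+ (suc m)) / 4
mainTheorem6 m = begin
  + 1 / D * sumℚ (map (λ b → + T b / 1 - + A b / D) (upTo D))   ≡⟨ cong (λ xs → + 1 / D * sumℚ xs) (map-cong summand (upTo D)) ⟩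
  + 1 / D * sumℚ (map (λ b → + offset n b / D) (upTo D))       ≡⟨ cong (_*_ (+ 1 / D)) (sumℚ-map-/ (offset n) D (upTo D)) ⟩
  + 1 / D * (+ S / D)                                          ≡⟨ /-*-/ (+ 1) (+ S) D D ⟩
  (+ 1 ℤ.* + S) / (D ℕ.* D)                                    ≡⟨ cong (λ i → i / (D ℕ.* D)) (ℤ.*-identityˡ (+ S)) ⟩
  + S / (D ℕ.* D)                                              ≡⟨ +/-≡-+/ S n (D ℕ.* D) 4 (sum-offset n) ⟩
  + n / 4                                                      ∎
  where
  open ≡-Reasoning
  n = suc m
  D = 2 ^ n
  instance
    D≢0 : NonZero D
    D≢0 = m^n≢0 2 n
    D*D≢0 : NonZero (D ℕ.* D)
    D*D≢0 = m*n≢0 D D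
  T = T1-iter n
  A = λ b → 3 ^ M m b ℕ.* b
  S = sum (map (offset n) (upTo D))
  summand : ∀ b → + T b / 1 - + A b / D ≡ + offset n b / D
  summand b = -/-≡-/ (T b) (A b) (offset n b) D (2^[1+m]*T1-iter≡3^M*b+offset m b)
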